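{- Let $\Sigma$ be an alphabet and let $L \subseteq \Sigma^*$ be a regular language. Then $L$ has a finite separating set of factors if and only if there do not exist words $w, x, y, z \in \Sigma^*$ with $wy \neq yw$ such that $x w^* y w^* z \subseteq L$.
   Context: For words $w, x$, $|w|_x$ denotes the number of occurrences of $x$ as a factor of $w$, i.e. the number of pairs of words $(s,t)$ with $w = sxt$ (so $|w|_\varepsilon = |w|+1$). A language $X$ is a separating set of factors (SSF) of a language $L$ if for all distinct $u, v \in L$ there exists $x \in X$ with $|u|_x \neq |v|_x$. -}

module Defs where

open import Data.Nat using (ℕ; zero; suc; _+_)
open import Data.Fin using (Fin)
open import Data.Fin.Properties using () renaming (_≟_ to _≟ᶠ_)
open import Data.List using (List; []; _∷_; _++_; foldl)
open import Data.List.Membership.Propositional using (_∈_)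
open import Data.Product using (Σ; ∃; _×_; _,_)
open import Data.Bool using (Bool; true; false; _∧_)
open import Data.Empty using (⊥)
open import Relation.Nullary using (¬_; does)
open import Relation.Binary.PropositionalEquality using (_≡_; _≢_)
open import Function.Bundles using (_⇔_)

Word : ℕ → Set
Word k = List (Fin k)

Language : ℕ → Set₁
Language k = Word k → Set

record DFA (k : ℕ) : Set where
  field
    n      : ℕ
    start  : Fin n
    δ      : Fin n → Fin k → Fin n
    final  : Fin n → Bool

  run : Fin n → Word k → Fin n
  run q w = foldl δ q w

  accepts : Word k → Bool
  accepts w = final (run start w)

IsRegular : {k : ℕ} → Language k → Set
IsRegular {k} L = Σ (DFA k) λ A → (w : Word k) → L w ⇔ (DFA.accepts A w ≡ true)

isPrefix : {k : ℕ} → Word k → Word k → Bool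
isPrefix [] w = true
isPrefix (a ∷ x) [] = false
isPrefix (a ∷ x) (b ∷ w) = does (a ≟ᶠ b) ∧ isPrefix x w

-- |w|_x : the number of pairs (s,t) with w = s x t, computed as the number
-- of suffixes (including w itself and ε) of w having x as a prefix.
occ : {k : ℕ} → Word k → Word k → ℕ
occ w x = here + rest w
  where
    here : ℕ
    here with isPrefix x w
    ... | true  = 1
    ... | false = 0
    rest : Word _ → ℕ
    rest []      = 0
    rest (_ ∷ w') = occ w' x

IsSSF : {k : ℕ} → List (Word k) → Language k → Set
IsSSF {k} X L = (u v : Word k) → L u → L v → u ≢ v →
  Σ (Word k) λ x → x ∈ X × occ u x ≢ occ v x

HasFiniteSSF : {k : ℕ} → Language k → Set
HasFiniteSSF {k} L = Σ (List (Word k)) λ X → IsSSF X L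

_^ʷ_ : {k : ℕ} → Word k → ℕ → Word k
w ^ʷ zero = []
w ^ʷ suc m = w ++ (w ^ʷ m)

module Submission where

-- Necessity: if the separating set only has words of length ≤ M, the words x wᴹ y wᴹ⁺¹ z
-- and x wᴹ⁺¹ y wᴹ z of L differ, yet have equal counts for all short factors (occ-swap,
-- built on the locality lemma occ-local).
--
-- Sufficiency: for a DFA with n states, B = n² and K = B + B², the words of length ≤ K + 1
-- separate.  Take accepted u = p a u₁ ≠ v = p b v₁ with equal short counts.  If |p| < K the
-- prefix p a is seen by counting (occ-extensions); otherwise p ends with t, |t| = K, and t b
-- recurs in t a u₁ (shifted-occurrence).  Pigeonhole on states pumps two loops whose factors
-- must commute, giving t a u₁ a period ≤ B up to position K (shift-period); likewise for
-- t b v₁, and the two small periods force a = b (periodic-agree).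

open import Defs
open import Data.Nat
open import Data.Nat.Properties
open import Data.Nat.Induction using (<-wellFounded)
open import Data.Nat.Tactic.RingSolver using (solve-∀)
open import Induction.WellFounded using (Acc; acc)
open import Algebra.Properties.CommutativeMonoid.Sum +-0-commutativeMonoid
  using (sum-syntax; ∑-distrib-+; sum-cong-≗; sum-replicate-zero)
open import Data.Bool using (Bool; true; false; _∧_)
open import Data.Empty using (⊥; ⊥-elim)
open import Data.Fin using (Fin; zero; suc; toℕ; combine)
open import Data.Fin.Properties using (pigeonhole; combine-injective; toℕ<n) renaming (_≟_ to _≟ᶠ_)
open import Data.List using (List; []; _∷_; _++_; length; take; drop; allFin; cartesianProductWith)
open import Data.List.Properties
  using (≡-dec; foldl-++; ++-assoc; ++-identityʳ; ++-cancelˡ; ++-cancelʳ; length-++; length-take; length-drop;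
         take++drop≡id; drop-drop)
open import Data.List.Membership.Propositional using (_∈_; find; lose)
open import Data.List.Membership.Propositional.Properties using (∈-allFin; ∈-cartesianProductWith⁺)
open import Data.List.Relation.Unary.Any using (here; there; any?)
open import Data.Maybe using (Maybe; just; nothing)
open import Data.Maybe.Properties using (just-injective)
open import Data.Product using (Σ; ∃; ∃₂; _×_; _,_; proj₁; proj₂)
open import Function.Bundles using (_⇔_; Equivalence; mk⇔)
open import Relation.Binary.Definitions using (DecidableEquality)
open import Relation.Binary.PropositionalEquality
open import Relation.Nullary using (¬_; ¬?; Dec; yes; no; does)
open import Relation.Nullary.Decidable using (dec-true; dec-false; decidable-stable)

module _ {A : Set} where

  at : List A → ℕ → Maybe A
  at []       _       = nothing
  at (x ∷ xs) zero    = just x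
  at (x ∷ xs) (suc i) = at xs i

  at-++ˡ : (xs ys : List A) {i : ℕ} → i < length xs → at (xs ++ ys) i ≡ at xs i
  at-++ˡ (x ∷ xs) ys {zero}  _         = refl
  at-++ˡ (x ∷ xs) ys {suc i} (s≤s i<n) = at-++ˡ xs ys i<n

  at-++ʳ : (xs ys : List A) (i : ℕ) → at (xs ++ ys) (length xs + i) ≡ at ys i
  at-++ʳ []       ys i = refl
  at-++ʳ (x ∷ xs) ys i = at-++ʳ xs ys i

  at-drop : (i j : ℕ) (xs : List A) → at (drop i xs) j ≡ at xs (i + j)
  at-drop zero    j xs       = refl
  at-drop (suc i) j []       = refl
  at-drop (suc i) j (x ∷ xs) = at-drop i j xs

  at-common-prefix : (xs ys zs : List A) {i : ℕ} → i < length xs → at (xs ++ ys) i ≡ at (xs ++ zs) i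
  at-common-prefix xs ys zs i<n = trans (at-++ˡ xs ys i<n) (sym (at-++ˡ xs zs i<n))

  take-+ : (i j : ℕ) (xs : List A) → take (i + j) xs ≡ take i xs ++ take j (drop i xs)
  take-+ zero    j xs       = refl
  take-+ (suc i) zero    []       = refl
  take-+ (suc i) (suc j) []       = refl
  take-+ (suc i) j       (x ∷ xs) = cong (x ∷_) (take-+ i j xs)

  drop-slice : (i j : ℕ) (xs : List A) → drop i xs ≡ take j (drop i xs) ++ drop (i + j) xs
  drop-slice i j xs = trans (sym (take++drop≡id j (drop i xs))) (cong (take j (drop i xs) ++_) (drop-drop i j xs))

  drop-++-length : (xs ys : List A) → drop (length xs) (xs ++ ys) ≡ ys
  drop-++-length []       ys = refl
  drop-++-length (x ∷ xs) ys = drop-++-length xs ys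

  length-slice : (i j : ℕ) (xs : List A) → i + j ≤ length xs → length (take j (drop i xs)) ≡ j
  length-slice i j xs i+j≤n = trans (length-take j (drop i xs))
    (m≤n⇒m⊓n≡m (subst (j ≤_) (sym (length-drop i xs)) (m+n≤o⇒m≤o∸n j (subst (_≤ length xs) (+-comm i j) i+j≤n))))

  slice-++ˡ : (i j : ℕ) (xs ys : List A) → i + j ≤ length xs → take j (drop i (xs ++ ys)) ≡ take j (drop i xs)
  slice-++ˡ zero    zero    xs       ys _ = refl
  slice-++ˡ zero    (suc j) (x ∷ xs) ys (s≤s le) = cong (x ∷_) (slice-++ˡ zero j xs ys le)
  slice-++ˡ (suc i) j       (x ∷ xs) ys (s≤s le) = slice-++ˡ i j xs ys le

  at-length : (xs ys : List A) (y : A) → at (xs ++ y ∷ ys) (length xs) ≡ just y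
  at-length xs ys y = trans (cong (at (xs ++ y ∷ ys)) (sym (+-identityʳ (length xs)))) (at-++ʳ xs (y ∷ ys) 0)

  first-difference : DecidableEquality A → (u v : List A) → u ≢ v → length u ≡ length v →
                     Σ (List A) λ p → Σ A λ a → Σ A λ b → Σ (List A) λ u₁ → Σ (List A) λ v₁ →
                     a ≢ b × u ≡ p ++ a ∷ u₁ × v ≡ p ++ b ∷ v₁
  first-difference _≟_ []      []      u≢v _ = ⊥-elim (u≢v refl)
  first-difference _≟_ (a ∷ u) (b ∷ v) u≢v |u|≡|v| with a ≟ b
  ... | no a≢b   = [] , a , b , u , v , a≢b , refl , refl
  ... | yes refl with first-difference _≟_ u v (λ u≡v → u≢v (cong (a ∷_) u≡v)) (suc-injective |u|≡|v|)
  ...   | p , a′ , b′ , u₁ , v₁ , a′≢b′ , refl , refl = a ∷ p , a′ , b′ , u₁ , v₁ , a′≢b′ , refl , refl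

  Periodic : List A → (Q lo hi : ℕ) → Set
  Periodic X Q lo hi = (z : ℕ) → lo ≤ z → z + Q < hi → at X (z + Q) ≡ at X z

  periodic-mono : (X : List A) {Q lo lo′ hi hi′ : ℕ} → lo ≤ lo′ → hi′ ≤ hi →
                  Periodic X Q lo hi → Periodic X Q lo′ hi′
  periodic-mono X lo≤lo′ hi′≤hi per z lo′≤z lt = per z (≤-trans lo≤lo′ lo′≤z) (<-≤-trans lt hi′≤hi)

  periodic-iterate : (X : List A) {Q lo hi : ℕ} → Periodic X Q lo hi →
                     (m z : ℕ) → lo ≤ z → z + m * Q < hi → at X (z + m * Q) ≡ at X z
  periodic-iterate X per zero    z lo≤z _  = cong (at X) (+-identityʳ z)
  periodic-iterate X {Q} {lo} {hi} per (suc m) z lo≤z lt = begin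
    at X (z + (Q + m * Q)) ≡⟨ cong (at X) (regroup z Q (m * Q)) ⟩
    at X (z + m * Q + Q)   ≡⟨ per (z + m * Q) (≤-trans lo≤z (m≤m+n z (m * Q))) (subst (_< hi) (regroup z Q (m * Q)) lt) ⟩
    at X (z + m * Q)       ≡⟨ periodic-iterate X per m z lo≤z (≤-<-trans (+-monoʳ-≤ z (m≤n+m (m * Q) Q)) lt) ⟩
    at X z                 ∎
    where
    open ≡-Reasoning
    regroup : (a b c : ℕ) → a + (b + c) ≡ a + c + b
    regroup = solve-∀

  -- A factor T ++ Y ++ T where T commutes with Y has period |T|: both
  -- T Y T and T (T Y) = T (Y T) begin with the word T Y.
  periodic-of-commuting : (X T Y Z : List A) (c : ℕ) → drop c X ≡ T ++ Y ++ T ++ Z → T ++ Y ≡ Y ++ T →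
                          Periodic X (length T) c (c + (length T + length Y) + length T)
  periodic-of-commuting X T Y Z c split comm z c≤z lt with m≤n⇒∃[o]m+o≡n c≤z
  ... | j , refl = begin
    at X (c + j + length T)                ≡⟨ cong (at X) (regroup c j (length T)) ⟩
    at X (c + (length T + j))              ≡⟨ sym (at-drop c _ X) ⟩
    at (drop c X) (length T + j)           ≡⟨ cong (λ W → at W (length T + j)) split ⟩
    at (T ++ Y ++ T ++ Z) (length T + j)   ≡⟨ at-++ʳ T _ j ⟩
    at (Y ++ T ++ Z) j                     ≡⟨ cong (λ W → at W j) (trans (sym (++-assoc Y T Z)) (cong (_++ Z) (sym comm))) ⟩
    at ((T ++ Y) ++ Z) j                   ≡⟨ at-common-prefix (T ++ Y) Z (T ++ Z) j<TY ⟩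
    at ((T ++ Y) ++ T ++ Z) j              ≡⟨ cong (λ W → at W j) (trans (++-assoc T Y (T ++ Z)) (sym split)) ⟩
    at (drop c X) j                        ≡⟨ at-drop c j X ⟩
    at X (c + j)                           ∎
    where
    open ≡-Reasoning
    regroup : (a b c : ℕ) → a + b + c ≡ a + (c + b)
    regroup = solve-∀
    j<TY : j < length (T ++ Y)
    j<TY = subst (j <_) (sym (length-++ T))
             (+-cancelʳ-< (length T) j _ (+-cancelˡ-< c _ _ (subst₂ _<_ (+-assoc c j _) (+-assoc c _ _) lt)))

  periodic-of-shift : (X t D R₁ R₂ : List A) → X ≡ t ++ R₁ → X ≡ D ++ t ++ R₂ →
                      Periodic X (length D) 0 (length D + length t)
  periodic-of-shift X t D R₁ R₂ eq₁ eq₂ z _ lt = begin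
    at X (z + length D)        ≡⟨ cong₂ at eq₂ (+-comm z (length D)) ⟩
    at (D ++ t ++ R₂) (length D + z) ≡⟨ at-++ʳ D (t ++ R₂) z ⟩
    at (t ++ R₂) z             ≡⟨ at-common-prefix t R₂ R₁ z<t ⟩
    at (t ++ R₁) z             ≡⟨ cong (λ W → at W z) (sym eq₁) ⟩
    at X z                     ∎
    where
    open ≡-Reasoning
    z<t : z < length t
    z<t = +-cancelˡ-< (length D) z _ (subst (_< length D + length t) (+-comm z (length D)) lt)

  -- Overlapping periods: if X has period d on [lo, hi) and period P on a window
  -- [c, c + d + P) of length d + P with lo ≤ c, then P is a period on all of [c, hi).
  -- A position beyond the window is moved back by d, where the period P is known.
  periodic-extend : (X : List A) {d P lo c hi : ℕ} → 1 ≤ d → lo ≤ c →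
                    Periodic X d lo hi → Periodic X P c (c + d + P) → Periodic X P c hi
  periodic-extend X {d} {P} {lo} {c} {hi} 1≤d lo≤c perD perW z = go z (<-wellFounded z)
    where
    open ≡-Reasoning
    go : (z : ℕ) → Acc _<_ z → c ≤ z → z + P < hi → at X (z + P) ≡ at X z
    go z (acc rec) c≤z lt with z <? c + d
    ... | yes z<c+d = perW z c≤z (+-monoˡ-< P z<c+d)
    ... | no z≮c+d with m≤n⇒∃[o]m+o≡n (≤-trans (m≤n+m d c) (≮⇒≥ z≮c+d))
    ...   | y , refl = begin
      at X (d + y + P)   ≡⟨ cong (at X) (regroup d y P) ⟩
      at X (y + P + d)   ≡⟨ perD (y + P) (≤-trans lo≤y (m≤m+n y P)) (subst (_< hi) (regroup d y P) lt) ⟩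
      at X (y + P)       ≡⟨ go y (rec (m<n+m y 1≤d)) c≤y (<-≤-trans (+-monoˡ-< P (m<n+m y 1≤d)) (<⇒≤ lt)) ⟩
      at X y             ≡⟨ sym (perD y lo≤y (subst (_< hi) (+-comm d y) (≤-<-trans (m≤m+n (d + y) P) lt))) ⟩
      at X (y + d)       ≡⟨ cong (at X) (+-comm y d) ⟩
      at X (d + y)       ∎
      where
      regroup : (a b c : ℕ) → a + b + c ≡ b + c + a
      regroup = solve-∀
      c≤y : c ≤ y
      c≤y = +-cancelˡ-≤ d c y (subst (_≤ d + y) (+-comm c d) (≮⇒≥ z≮c+d))
      lo≤y : lo ≤ y
      lo≤y = ≤-trans lo≤c c≤y

  -- Two periodic tails force a letter (a weak Fine–Wilf argument): if X and X′ agree below K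
  -- and have periods Q, Q′ on [B, K], then position K is a common multiple Q·Q′ beyond the
  -- position K − Q·Q′ ≥ B, where X and X′ agree.
  periodic-agree : (X X′ : List A) {B Q Q′ K : ℕ} → ((i : ℕ) → i < K → at X i ≡ at X′ i) →
                   1 ≤ Q → 1 ≤ Q′ → B + Q * Q′ ≤ K →
                   Periodic X Q B (suc K) → Periodic X′ Q′ B (suc K) → at X K ≡ at X′ K
  periodic-agree X X′ {B} {Q} {Q′} {K} agree 1≤Q 1≤Q′ bound per per′ = begin
    at X K               ≡⟨ cong (at X) (sym z₀+Q′Q) ⟩
    at X (z₀ + Q′ * Q)   ≡⟨ periodic-iterate X per Q′ z₀ B≤z₀ (s≤s (≤-reflexive z₀+Q′Q)) ⟩
    at X z₀              ≡⟨ agree z₀ z₀<K ⟩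
    at X′ z₀             ≡⟨ sym (periodic-iterate X′ per′ Q z₀ B≤z₀ (s≤s (≤-reflexive z₀+QQ′))) ⟩
    at X′ (z₀ + Q * Q′)  ≡⟨ cong (at X′) z₀+QQ′ ⟩
    at X′ K              ∎
    where
    open ≡-Reasoning
    R = Q * Q′
    z₀ = K ∸ R
    z₀+QQ′ : z₀ + R ≡ K
    z₀+QQ′ = m∸n+n≡m (≤-trans (m≤n+m R B) bound)
    z₀+Q′Q : z₀ + Q′ * Q ≡ K
    z₀+Q′Q = trans (cong (z₀ +_) (*-comm Q′ Q)) z₀+QQ′
    B≤z₀ : B ≤ z₀
    B≤z₀ = m+n≤o⇒m≤o∸n B bound
    z₀<K : z₀ < K
    z₀<K = subst (z₀ <_) z₀+QQ′ (m<m+n z₀ (*-mono-≤ 1≤Q 1≤Q′))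

ind : Bool → ℕ
ind true  = 1
ind false = 0

ind-injective : {b b′ : Bool} → ind b ≡ ind b′ → b ≡ b′
ind-injective {true}  {true}  _ = refl
ind-injective {false} {false} _ = refl

sum-indicator : {k : ℕ} (a : Fin k) (b : Bool) → ∑[ c < k ] ind (does (c ≟ᶠ a) ∧ b) ≡ ind b
sum-indicator {suc k} zero    b = trans (cong (ind b +_) (sum-replicate-zero k)) (+-identityʳ (ind b))
sum-indicator {suc k} (suc a) b = sum-indicator a b

module _ {k : ℕ} where

  occ-nil : (x : Word k) → occ [] x ≡ ind (isPrefix x [])
  occ-nil x with isPrefix x []
  ... | true  = refl
  ... | false = refl

  occ-cons : (c : Fin k) (w x : Word k) → occ (c ∷ w) x ≡ ind (isPrefix x (c ∷ w)) + occ w x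
  occ-cons c w x with isPrefix x (c ∷ w)
  ... | true  = refl
  ... | false = refl

  -- The empty word occurs |w| + 1 times in w; so equal counts of ε force equal lengths.
  occ-ε : (w : Word k) → occ w [] ≡ suc (length w)
  occ-ε []      = refl
  occ-ε (c ∷ w) = trans (occ-cons c w []) (cong suc (occ-ε w))

  occ-prefix : (w x : Word k) → isPrefix x w ≡ true → 1 ≤ occ w x
  occ-prefix []      x eq = subst (1 ≤_) (sym (trans (occ-nil x) (cong ind eq))) ≤-refl
  occ-prefix (c ∷ w) x eq = subst (1 ≤_) (sym (trans (occ-cons c w x) (cong (λ b → ind b + occ w x) eq))) (s≤s z≤n)

  isPrefix-refl : (x r : Word k) → isPrefix x (x ++ r) ≡ true
  isPrefix-refl []      r = refl
  isPrefix-refl (c ∷ x) r rewrite dec-true (c ≟ᶠ c) refl = isPrefix-refl x r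

  isPrefix-cancel : (t x y : Word k) → isPrefix (t ++ x) (t ++ y) ≡ isPrefix x y
  isPrefix-cancel []      x y = refl
  isPrefix-cancel (c ∷ t) x y rewrite dec-true (c ≟ᶠ c) refl = isPrefix-cancel t x y

  isPrefix-mismatch : (t x y : Word k) {a b : Fin k} → a ≢ b → isPrefix (t ++ a ∷ x) (t ++ b ∷ y) ≡ false
  isPrefix-mismatch t x y {a} {b} a≢b rewrite isPrefix-cancel t (a ∷ x) (b ∷ y) | dec-false (a ≟ᶠ b) a≢b = refl

  isPrefix-++ : (x m y y′ : Word k) → length x ≤ length m → isPrefix x (m ++ y) ≡ isPrefix x (m ++ y′)
  isPrefix-++ []      m       y y′ _        = refl
  isPrefix-++ (c ∷ x) (d ∷ m) y y′ (s≤s le) = cong (does (c ≟ᶠ d) ∧_) (isPrefix-++ x m y y′ le)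

  isPrefix-sound : (x w : Word k) → isPrefix x w ≡ true → ∃ λ r → w ≡ x ++ r
  isPrefix-sound []      w       _  = w , refl
  isPrefix-sound (c ∷ x) (d ∷ w) eq with c ≟ᶠ d
  ... | yes refl = let r , w≡xr = isPrefix-sound x w eq in r , cong (c ∷_) w≡xr

  -- Locality of counting: an occurrence of x (with |x| ≤ |s| + 1) starting inside p
  -- lies inside p ++ s, so p contributes equally to the counts in p s y and p s y′.
  occ-local : (p s y y′ x : Word k) → length x ≤ suc (length s) →
              occ (p ++ s ++ y) x + occ (s ++ y′) x ≡ occ (p ++ s ++ y′) x + occ (s ++ y) x
  occ-local []      s y y′ x _  = +-comm (occ (s ++ y) x) (occ (s ++ y′) x)
  occ-local (c ∷ p) s y y′ x le = begin
    occ (c ∷ p ++ s ++ y) x + occ (s ++ y′) x      ≡⟨ cong (_+ occ (s ++ y′) x) (occ-cons c _ x) ⟩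
    (h + occ (p ++ s ++ y) x) + occ (s ++ y′) x    ≡⟨ +-assoc h _ _ ⟩
    h + (occ (p ++ s ++ y) x + occ (s ++ y′) x)    ≡⟨ cong₂ _+_ h≡h′ (occ-local p s y y′ x le) ⟩
    h′ + (occ (p ++ s ++ y′) x + occ (s ++ y) x)   ≡⟨ sym (+-assoc h′ _ _) ⟩
    (h′ + occ (p ++ s ++ y′) x) + occ (s ++ y) x   ≡⟨ cong (_+ occ (s ++ y) x) (sym (occ-cons c _ x)) ⟩
    occ (c ∷ p ++ s ++ y′) x + occ (s ++ y) x      ∎
    where
    open ≡-Reasoning
    h  = ind (isPrefix x (c ∷ p ++ s ++ y))
    h′ = ind (isPrefix x (c ∷ p ++ s ++ y′))
    x≤cps : length x ≤ length (c ∷ p ++ s)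
    x≤cps = ≤-trans le (s≤s (subst (length s ≤_) (sym (length-++ p)) (m≤n+m (length s) (length p))))
    h≡h′ : h ≡ h′
    h≡h′ = cong ind (begin
      isPrefix x (c ∷ p ++ s ++ y)    ≡⟨ cong (λ w → isPrefix x (c ∷ w)) (sym (++-assoc p s y)) ⟩
      isPrefix x ((c ∷ p ++ s) ++ y)  ≡⟨ isPrefix-++ x (c ∷ p ++ s) y y′ x≤cps ⟩
      isPrefix x ((c ∷ p ++ s) ++ y′) ≡⟨ cong (λ w → isPrefix x (c ∷ w)) (++-assoc p s y′) ⟩
      isPrefix x (c ∷ p ++ s ++ y′)   ∎)

  -- Every occurrence of f either is a prefix or extends to the left by a unique letter c.
  occ-extensions : (u f : Word k) → occ u f ≡ ind (isPrefix f u) + ∑[ c < k ] occ u (c ∷ f)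
  occ-extensions []      f = begin
    occ [] f                            ≡⟨ occ-nil f ⟩
    ind (isPrefix f [])                 ≡⟨ sym (+-identityʳ _) ⟩
    ind (isPrefix f []) + 0             ≡⟨ cong (ind (isPrefix f []) +_) (sym (sum-replicate-zero k)) ⟩
    ind (isPrefix f []) + ∑[ c < k ] 0  ∎
    where open ≡-Reasoning
  occ-extensions (a ∷ u) f = begin
    occ (a ∷ u) f                                                 ≡⟨ occ-cons a u f ⟩
    h + occ u f                                                   ≡⟨ cong (h +_) (occ-extensions u f) ⟩
    h + (ind (isPrefix f u) + ∑[ c < k ] occ u (c ∷ f))           ≡⟨ cong (λ n → h + (n + _)) (sym (sum-indicator a (isPrefix f u))) ⟩
    h + (∑[ c < k ] new c + ∑[ c < k ] occ u (c ∷ f))              ≡⟨ cong (h +_) (sym (∑-distrib-+ new (λ c → occ u (c ∷ f)))) ⟩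
    h + ∑[ c < k ] (new c + occ u (c ∷ f))                         ≡⟨ cong (h +_) (sum-cong-≗ (λ c → sym (occ-cons a u (c ∷ f)))) ⟩
    h + ∑[ c < k ] occ (a ∷ u) (c ∷ f)                             ∎
    where
    open ≡-Reasoning
    h = ind (isPrefix f (a ∷ u))
    new : Fin k → ℕ
    new c = ind (does (c ≟ᶠ a) ∧ isPrefix f u)

  prefix-from-counts : (u v f : Word k) → occ u f ≡ occ v f → ((c : Fin k) → occ u (c ∷ f) ≡ occ v (c ∷ f)) →
                       isPrefix f u ≡ isPrefix f v
  prefix-from-counts u v f eq eqs = ind-injective (+-cancelʳ-≡ (∑[ c < k ] occ u (c ∷ f)) _ _ (begin
    ind (isPrefix f u) + ∑[ c < k ] occ u (c ∷ f)  ≡⟨ sym (occ-extensions u f) ⟩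
    occ u f                                       ≡⟨ eq ⟩
    occ v f                                       ≡⟨ occ-extensions v f ⟩
    ind (isPrefix f v) + ∑[ c < k ] occ v (c ∷ f)  ≡⟨ cong (ind (isPrefix f v) +_) (sym (sum-cong-≗ eqs)) ⟩
    ind (isPrefix f v) + ∑[ c < k ] occ u (c ∷ f)  ∎))
    where open ≡-Reasoning

  occ-find : (w x : Word k) → 1 ≤ occ w x → ∃₂ λ s r → w ≡ s ++ x ++ r
  occ-nonprefix : (w x : Word k) → isPrefix x w ≡ false → 1 ≤ occ w x →
                  ∃₂ λ D r → 1 ≤ length D × w ≡ D ++ x ++ r

  occ-find w x le = by-cases (isPrefix x w) refl
    where
    by-cases : (b : Bool) → isPrefix x w ≡ b → ∃₂ λ s r → w ≡ s ++ x ++ r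
    by-cases true  eq = let r , w≡xr = isPrefix-sound x w eq in [] , r , w≡xr
    by-cases false eq = let D , r , _ , w≡Dxr = occ-nonprefix w x eq le in D , r , w≡Dxr

  occ-nonprefix []      x eq le with () ← subst (1 ≤_) (trans (occ-nil x) (cong ind eq)) le
  occ-nonprefix (c ∷ w) x eq le =
    let s , r , w≡sxr = occ-find w x (subst (1 ≤_) (trans (occ-cons c w x) (cong (λ b → ind b + occ w x) eq)) le)
    in c ∷ s , r , s≤s z≤n , cong (c ∷_) w≡sxr

  -- If u = p₀ t a u₁ and v = p₀ t b v₁ (a ≠ b) contain
  -- t b equally often, then by locality so do t a u₁ and t b v₁; as t b is a prefix of
  -- the latter, it occurs in t a u₁, necessarily at a positive position.
  shifted-occurrence : (p₀ t u₁ v₁ : Word k) {a b : Fin k} → a ≢ b →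
                       occ (p₀ ++ t ++ a ∷ u₁) (t ++ b ∷ []) ≡ occ (p₀ ++ t ++ b ∷ v₁) (t ++ b ∷ []) →
                       ∃₂ λ D r → 1 ≤ length D × t ++ a ∷ u₁ ≡ D ++ t ++ b ∷ r
  shifted-occurrence p₀ t u₁ v₁ {a} {b} a≢b same
    with occ-nonprefix (t ++ a ∷ u₁) tb (isPrefix-mismatch t [] u₁ (λ b≡a → a≢b (sym b≡a))) occurs
    where
    tb = t ++ b ∷ []
    tb≤ : length tb ≤ suc (length t)
    tb≤ = ≤-reflexive (trans (length-++ t) (+-comm (length t) 1))
    same′ : occ (t ++ b ∷ v₁) tb ≡ occ (t ++ a ∷ u₁) tb
    same′ = +-cancelˡ-≡ (occ (p₀ ++ t ++ a ∷ u₁) tb) _ _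
              (trans (occ-local p₀ t (a ∷ u₁) (b ∷ v₁) tb tb≤) (cong (_+ occ (t ++ a ∷ u₁) tb) (sym same)))
    occurs : 1 ≤ occ (t ++ a ∷ u₁) tb
    occurs = subst (1 ≤_) same′ (occ-prefix (t ++ b ∷ v₁) tb
               (subst (λ w → isPrefix tb w ≡ true) (++-assoc t (b ∷ []) v₁) (isPrefix-refl tb v₁)))
  ... | D , r , 1≤D , eq = D , r , 1≤D , trans eq (cong (D ++_) (++-assoc t (b ∷ []) r))

  length-bound : (X : List (Word k)) → ∃ λ M → {f : Word k} → f ∈ X → length f ≤ M
  length-bound []      = 0 , λ ()
  length-bound (g ∷ X) with length-bound X
  ... | M , bound = length g + M , λ { (here refl) → m≤m+n (length g) M ; (there f∈X) → ≤-trans (bound f∈X) (m≤n+m M (length g)) }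

  ^ʷ-comm : (w : Word k) (m : ℕ) → w ++ (w ^ʷ m) ≡ (w ^ʷ m) ++ w
  ^ʷ-comm w zero    = ++-identityʳ w
  ^ʷ-comm w (suc m) = trans (cong (w ++_) (^ʷ-comm w m)) (sym (++-assoc w (w ^ʷ m) w))

  length-^ʷ : (w : Word k) (m : ℕ) → length (w ^ʷ m) ≡ m * length w
  length-^ʷ w zero    = refl
  length-^ʷ w (suc m) = trans (length-++ w) (cong (length w +_) (length-^ʷ w m))

  occ-swap : (x α w y z f : Word k) → w ++ α ≡ α ++ w → length f ≤ suc (length α) →
             occ (x ++ α ++ y ++ w ++ α ++ z) f ≡ occ (x ++ w ++ α ++ y ++ α ++ z) f
  occ-swap x α w y z f comm le = +-cancelʳ-≡ (occ (α ++ w ++ y ++ α ++ z) f) _ _ (begin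
    occ (x ++ α ++ y ++ w ++ α ++ z) f + occ (α ++ w ++ y ++ α ++ z) f ≡⟨ occ-local x α _ _ f le ⟩
    occ (x ++ α ++ w ++ y ++ α ++ z) f + occ (α ++ y ++ w ++ α ++ z) f ≡⟨ cong₂ _+_ (cong (λ v → occ (x ++ v) f) (slide _)) (sym inner) ⟩
    occ (x ++ w ++ α ++ y ++ α ++ z) f + occ (α ++ w ++ y ++ α ++ z) f ∎)
    where
    open ≡-Reasoning
    slide : (r : Word k) → α ++ w ++ r ≡ w ++ α ++ r
    slide r = trans (sym (++-assoc α w r)) (trans (cong (_++ r) (sym comm)) (++-assoc w α r))
    inner : occ (α ++ w ++ y ++ α ++ z) f ≡ occ (α ++ y ++ w ++ α ++ z) f
    inner = +-cancelʳ-≡ (occ (α ++ z) f) _ _ (begin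
      occ (α ++ w ++ y ++ α ++ z) f + occ (α ++ z) f     ≡⟨ cong (λ v → occ v f + occ (α ++ z) f) (slide _) ⟩
      occ (w ++ α ++ y ++ α ++ z) f + occ (α ++ z) f     ≡⟨ occ-local w α (y ++ α ++ z) z f le ⟩
      occ (w ++ α ++ z) f + occ (α ++ y ++ α ++ z) f     ≡⟨ +-comm (occ (w ++ α ++ z) f) _ ⟩
      occ (α ++ y ++ α ++ z) f + occ (w ++ α ++ z) f     ≡⟨ cong₂ (λ v v′ → occ v f + occ v′ f) (sym (++-assoc α y _)) (sym (slide z)) ⟩
      occ ((α ++ y) ++ α ++ z) f + occ (α ++ w ++ z) f   ≡⟨ sym (occ-local (α ++ y) α (w ++ z) z f le) ⟩
      occ ((α ++ y) ++ α ++ w ++ z) f + occ (α ++ z) f   ≡⟨ cong (λ v → occ v f + occ (α ++ z) f) (trans (++-assoc α y _) (cong (λ v → α ++ y ++ v) (slide z))) ⟩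
      occ (α ++ y ++ w ++ α ++ z) f + occ (α ++ z) f     ∎)

  swap-distinct : (x α w y z : Word k) → w ++ α ≡ α ++ w → w ++ y ≢ y ++ w →
                  x ++ α ++ y ++ w ++ α ++ z ≢ x ++ w ++ α ++ y ++ α ++ z
  swap-distinct x α w y z comm wy≢yw eq = wy≢yw (sym (++-cancelʳ (α ++ z) (y ++ w) (w ++ y) (begin
    (y ++ w) ++ α ++ z   ≡⟨ ++-assoc y w _ ⟩
    y ++ w ++ α ++ z     ≡⟨ ++-cancelˡ α _ _ (++-cancelˡ x _ _ eq′) ⟩
    w ++ y ++ α ++ z     ≡⟨ sym (++-assoc w y _) ⟩
    (w ++ y) ++ α ++ z   ∎)))
    where
    open ≡-Reasoning
    eq′ : x ++ α ++ y ++ w ++ α ++ z ≡ x ++ α ++ w ++ y ++ α ++ z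
    eq′ = trans eq (cong (x ++_) (trans (sym (++-assoc w α _)) (trans (cong (_++ _) comm) (++-assoc α w _))))

HasPattern : {k : ℕ} → Language k → Set
HasPattern {k} L = Σ (Word k) λ w → Σ (Word k) λ x → Σ (Word k) λ y → Σ (Word k) λ z →
  (w ++ y ≢ y ++ w) × ((i j : ℕ) → L (x ++ (w ^ʷ i) ++ y ++ (w ^ʷ j) ++ z))

finiteSSF⇒noPattern : {k : ℕ} (L : Language k) → HasFiniteSSF L → ¬ HasPattern L
finiteSSF⇒noPattern L _ ([] , x , y , z , wy≢yw , _) = wy≢yw (sym (++-identityʳ y))
finiteSSF⇒noPattern L (X , separates) (w@(_ ∷ _) , x , y , z , wy≢yw , inL) =
  let f , f∈X , counts≢ = separates _ _ (inL M (suc M)) (inL (suc M) M) distinct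
  in counts≢ (same-counts f∈X)
  where
  M = proj₁ (length-bound X)
  α = w ^ʷ M
  reassoc : (r : Word _) → x ++ α ++ y ++ (w ^ʷ suc M) ++ r ≡ x ++ α ++ y ++ w ++ α ++ r
  reassoc r = cong (λ v → x ++ α ++ y ++ v) (++-assoc w α r)
  reassoc′ : (r : Word _) → x ++ (w ^ʷ suc M) ++ r ≡ x ++ w ++ α ++ r
  reassoc′ r = cong (x ++_) (++-assoc w α r)
  distinct : x ++ α ++ y ++ (w ^ʷ suc M) ++ z ≢ x ++ (w ^ʷ suc M) ++ y ++ α ++ z
  distinct eq = swap-distinct x α w y z (^ʷ-comm w M) wy≢yw (trans (sym (reassoc z)) (trans eq (reassoc′ _)))
  same-counts : {f : Word _} → f ∈ X → occ (x ++ α ++ y ++ (w ^ʷ suc M) ++ z) f ≡ occ (x ++ (w ^ʷ suc M) ++ y ++ α ++ z) f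
  same-counts {f} f∈X = begin
    occ (x ++ α ++ y ++ (w ^ʷ suc M) ++ z) f ≡⟨ cong (λ v → occ v f) (reassoc z) ⟩
    occ (x ++ α ++ y ++ w ++ α ++ z) f       ≡⟨ occ-swap x α w y z f (^ʷ-comm w M) f≤α ⟩
    occ (x ++ w ++ α ++ y ++ α ++ z) f       ≡⟨ cong (λ v → occ v f) (sym (reassoc′ _)) ⟩
    occ (x ++ (w ^ʷ suc M) ++ y ++ α ++ z) f ∎
    where
    open ≡-Reasoning
    f≤α : length f ≤ suc (length α)
    f≤α = ≤-trans (proj₂ (length-bound X) f∈X)
            (≤-trans (m≤m*n M (length w)) (≤-trans (≤-reflexive (sym (length-^ʷ w M))) (n≤1+n _)))

repeated-pair : (m : ℕ) (s s′ : ℕ → Fin m) →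
                ∃₂ λ c P → 1 ≤ P × c + P ≤ m * m × s c ≡ s (c + P) × s′ c ≡ s′ (c + P)
repeated-pair m s s′ with pigeonhole (n<1+n (m * m)) (λ i → combine (s (toℕ i)) (s′ (toℕ i)))
... | i , j , i<j , same with m≤n⇒∃[o]m+o≡n i<j
...   | o , 1+i+o≡j with combine-injective (s (toℕ i)) (s′ (toℕ i)) (s (toℕ j)) (s′ (toℕ j)) same
...     | eq , eq′ = toℕ i , suc o , s≤s z≤n , bound , trans eq (cong s (sym i+P≡j)) , trans eq′ (cong s′ (sym i+P≡j))
  where
  i+P≡j : toℕ i + suc o ≡ toℕ j
  i+P≡j = trans (+-suc (toℕ i) o) 1+i+o≡j
  bound : toℕ i + suc o ≤ m * m
  bound = subst (_≤ m * m) (sym i+P≡j) (<⇒≤pred (toℕ<n j))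

module _ {k : ℕ} where

  wordsUpTo : ℕ → List (Word k)
  wordsUpTo zero    = [] ∷ []
  wordsUpTo (suc N) = [] ∷ cartesianProductWith _∷_ (allFin k) (wordsUpTo N)

  wordsUpTo-complete : (N : ℕ) (w : Word k) → length w ≤ N → w ∈ wordsUpTo N
  wordsUpTo-complete zero    []      _        = here refl
  wordsUpTo-complete (suc N) []      _        = here refl
  wordsUpTo-complete (suc N) (c ∷ w) (s≤s le) = there (∈-cartesianProductWith⁺ _∷_ (∈-allFin c) (wordsUpTo-complete N w le))

module _ {k : ℕ} (A : DFA k) where
  open DFA A

  run-++ : (q : Fin n) (u v : Word k) → run q (u ++ v) ≡ run (run q u) v
  run-++ q u v = foldl-++ δ q u v

  run-loop : {q : Fin n} (w : Word k) → run q w ≡ q → (i : ℕ) → run q (w ^ʷ i) ≡ q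
  run-loop w loop zero    = refl
  run-loop w loop (suc i) = trans (run-++ _ w (w ^ʷ i)) (trans (cong (λ q → run q (w ^ʷ i)) loop) (run-loop w loop i))

  pump-two-loops : {q₀ q₁ q₂ : Fin n} (x T Y Z : Word k) → run q₀ x ≡ q₁ → run q₁ T ≡ q₁ →
                   run q₁ Y ≡ q₂ → run q₂ T ≡ q₂ → (i j : ℕ) →
                   run q₀ (x ++ (T ^ʷ i) ++ Y ++ (T ^ʷ j) ++ Z) ≡ run q₂ Z
  pump-two-loops {q₀} {q₁} {q₂} x T Y Z to₁ loop₁ to₂ loop₂ i j = begin
    run q₀ (x ++ (T ^ʷ i) ++ Y ++ (T ^ʷ j) ++ Z)  ≡⟨ run-++ q₀ x _ ⟩
    run (run q₀ x) ((T ^ʷ i) ++ Y ++ (T ^ʷ j) ++ Z) ≡⟨ cong (λ q → run q ((T ^ʷ i) ++ Y ++ (T ^ʷ j) ++ Z)) to₁ ⟩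
    run q₁ ((T ^ʷ i) ++ Y ++ (T ^ʷ j) ++ Z)       ≡⟨ run-++ q₁ (T ^ʷ i) _ ⟩
    run (run q₁ (T ^ʷ i)) (Y ++ (T ^ʷ j) ++ Z)    ≡⟨ cong (λ q → run q (Y ++ (T ^ʷ j) ++ Z)) (run-loop T loop₁ i) ⟩
    run q₁ (Y ++ (T ^ʷ j) ++ Z)                   ≡⟨ run-++ q₁ Y _ ⟩
    run (run q₁ Y) ((T ^ʷ j) ++ Z)                ≡⟨ cong (λ q → run q ((T ^ʷ j) ++ Z)) to₂ ⟩
    run q₂ ((T ^ʷ j) ++ Z)                        ≡⟨ run-++ q₂ (T ^ʷ j) Z ⟩
    run (run q₂ (T ^ʷ j)) Z                       ≡⟨ cong (λ q → run q Z) (run-loop T loop₂ j) ⟩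
    run q₂ Z                                      ∎
    where open ≡-Reasoning

module NoPattern {k : ℕ} (A : DFA k)
  (commutes : (T x Y Z : Word k) → ((i j : ℕ) → DFA.accepts A (x ++ (T ^ʷ i) ++ Y ++ (T ^ʷ j) ++ Z) ≡ true) →
              T ++ Y ≡ Y ++ T) where
  open DFA A

  B K : ℕ
  B = n * n
  K = B + B * B

  state : (p₀ X : Word k) → ℕ → Fin n
  state p₀ X i = run (run start p₀) (take i X)

  state-+ : (p₀ X : Word k) (i j : ℕ) → state p₀ X (i + j) ≡ run (state p₀ X i) (take j (drop i X))
  state-+ p₀ X i j = trans (cong (run (run start p₀)) (take-+ i j X)) (run-++ A _ (take i X) _)

  -- Two loops reading the same factor T, at positions c and e = c + |T| + |Y|, give an
  -- accepted pumped family; hence T Y = Y T, so X has period |T| on [c, e + |T|).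
  two-loops-period : (p₀ X : Word k) (c P m : ℕ) → accepts (p₀ ++ X) ≡ true → c + P + m ≤ length X →
                     take P (drop (c + P + m) X) ≡ take P (drop c X) →
                     state p₀ X c ≡ state p₀ X (c + P) →
                     state p₀ X (c + P + m) ≡ state p₀ X (c + P + m + P) →
                     Periodic X P c (c + (P + m) + P)
  two-loops-period p₀ X c P m accepted bound same-T repeat-c repeat-e =
    subst₂ (λ P′ m′ → Periodic X P′ c (c + (P′ + m′) + P′)) |T| |Y|
      (periodic-of-commuting X T Y Z c split (commutes T x Y Z pumped))
    where
    e = c + P + m
    T = take P (drop c X)
    Y = take m (drop (c + P) X)
    Z = drop (e + P) X
    x = p₀ ++ take c X
    split : drop c X ≡ T ++ Y ++ T ++ Z
    split = trans (drop-slice c P X) (cong (T ++_) (trans (drop-slice (c + P) m X)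
              (cong (Y ++_) (trans (drop-slice e P X) (cong (_++ Z) same-T)))))
    |T| : length T ≡ P
    |T| = length-slice c P X (≤-trans (m≤m+n (c + P) m) bound)
    |Y| : length Y ≡ m
    |Y| = length-slice (c + P) m X bound
    enter : run start x ≡ state p₀ X c
    enter = run-++ A start p₀ (take c X)
    T-loops-at-c : run (state p₀ X c) T ≡ state p₀ X c
    T-loops-at-c = trans (sym (state-+ p₀ X c P)) (sym repeat-c)
    Y-bridges : run (state p₀ X c) Y ≡ state p₀ X e
    Y-bridges = trans (cong (λ q → run q Y) repeat-c) (sym (state-+ p₀ X (c + P) m))
    T-loops-at-e : run (state p₀ X e) T ≡ state p₀ X e
    T-loops-at-e = trans (cong (run _) (sym same-T)) (trans (sym (state-+ p₀ X e P)) (sym repeat-e))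
    pumped : (i j : ℕ) → accepts (x ++ (T ^ʷ i) ++ Y ++ (T ^ʷ j) ++ Z) ≡ true
    pumped i j = begin
      final (run start (x ++ (T ^ʷ i) ++ Y ++ (T ^ʷ j) ++ Z)) ≡⟨ cong final (pump-two-loops A x T Y Z enter T-loops-at-c Y-bridges T-loops-at-e i j) ⟩
      final (run (state p₀ X e) Z)                             ≡⟨ cong (λ q → final (run q Z)) repeat-e ⟩
      final (run (state p₀ X (e + P)) Z)                       ≡⟨ cong final (sym (run-++ A _ (take (e + P) X) Z)) ⟩
      final (run (run start p₀) (take (e + P) X ++ Z))         ≡⟨ cong (λ w → final (run (run start p₀) w)) (take++drop≡id (e + P) X) ⟩
      final (run (run start p₀) X)                             ≡⟨ cong final (sym (run-++ A start p₀ X)) ⟩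
      accepts (p₀ ++ X)                                        ≡⟨ accepted ⟩
      true                                                     ∎
      where open ≡-Reasoning

  -- If an accepted word p₀ X has X = t R₁ = D t R₂ with |D| ≥ 1 and |t| ≥ B, then X has a
  -- period Q ≤ B on [B, |D| + |t|).  X has period d = |D| there; pigeonhole on the state
  -- pairs at positions c and d + c (c ≤ B) yields a loop of length P at both.  If d < P we
  -- keep d; otherwise the two loops give period P on a window of length d + P, which
  -- the period d propagates.
  shift-period : (p₀ X t D R₁ R₂ : Word k) → X ≡ t ++ R₁ → X ≡ D ++ t ++ R₂ → 1 ≤ length D → B ≤ length t →
                 accepts (p₀ ++ X) ≡ true → ∃ λ Q → 1 ≤ Q × Q ≤ B × Periodic X Q B (length D + length t)
  shift-period p₀ X t D R₁ R₂ eq₁ eq₂ 1≤d B≤t accepted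
    with repeated-pair n (state p₀ X) (λ i → state p₀ X (length D + i))
  ... | c , P , 1≤P , c+P≤B , same₁ , same₂ = by-cases (P ≤? d)
    where
    d = length D
    perD : Periodic X d 0 (d + length t)
    perD = periodic-of-shift X t D R₁ R₂ eq₁ eq₂
    P≤B : P ≤ B
    P≤B = ≤-trans (m≤n+m P c) c+P≤B
    by-cases : Dec (P ≤ d) → ∃ λ Q → 1 ≤ Q × Q ≤ B × Periodic X Q B (d + length t)
    by-cases (no P≰d)  = d , 1≤d , ≤-trans (<⇒≤ (≰⇒> P≰d)) P≤B , periodic-mono X z≤n ≤-refl perD
    by-cases (yes P≤d) = P , 1≤P , P≤B ,
                         periodic-mono X (≤-trans (m≤m+n c P) c+P≤B) ≤-refl (periodic-extend X 1≤d z≤n perD window)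
      where
      m = d ∸ P
      P+m≡d : P + m ≡ d
      P+m≡d = m+[n∸m]≡n P≤d
      e≡d+c : c + P + m ≡ d + c
      e≡d+c = trans (+-assoc c P m) (trans (cong (c +_) P+m≡d) (+-comm c d))
      c+P≤t : c + P ≤ length t
      c+P≤t = ≤-trans c+P≤B B≤t
      -- The factor of length P at position d + c repeats the one at c, both lying in t.
      same-T : take P (drop (c + P + m) X) ≡ take P (drop c X)
      same-T = begin
        take P (drop (c + P + m) X)      ≡⟨ cong (λ i → take P (drop i X)) e≡d+c ⟩
        take P (drop (d + c) X)          ≡⟨ cong (take P) (sym (drop-drop d c X)) ⟩
        take P (drop c (drop d X))       ≡⟨ cong (λ w → take P (drop c (drop d w))) eq₂ ⟩
        take P (drop c (drop d (D ++ t ++ R₂))) ≡⟨ cong (λ w → take P (drop c w)) (drop-++-length D (t ++ R₂)) ⟩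
        take P (drop c (t ++ R₂))        ≡⟨ slice-++ˡ c P t R₂ c+P≤t ⟩
        take P (drop c t)                ≡⟨ sym (slice-++ˡ c P t R₁ c+P≤t) ⟩
        take P (drop c (t ++ R₁))        ≡⟨ cong (λ w → take P (drop c w)) (sym eq₁) ⟩
        take P (drop c X)                ∎
        where open ≡-Reasoning
      bound : c + P + m ≤ length X
      bound = subst (_≤ length X) (sym e≡d+c) (begin
        d + c                    ≤⟨ +-monoʳ-≤ d (≤-trans (m≤m+n c P) c+P≤t) ⟩
        d + length t             ≤⟨ +-monoʳ-≤ d (m≤m+n (length t) (length R₂)) ⟩
        d + (length t + length R₂) ≡⟨ cong (d +_) (sym (length-++ t)) ⟩
        d + length (t ++ R₂)     ≡⟨ sym (length-++ D) ⟩
        length (D ++ t ++ R₂)    ≡⟨ cong length (sym eq₂) ⟩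
        length X                 ∎)
        where open ≤-Reasoning
      repeat-e : state p₀ X (c + P + m) ≡ state p₀ X (c + P + m + P)
      repeat-e = trans (cong (state p₀ X) e≡d+c) (trans same₂ (cong (state p₀ X) (sym (trans (cong (_+ P) e≡d+c) (+-assoc d c P)))))
      window : Periodic X P c (c + d + P)
      window = subst (λ d′ → Periodic X P c (c + d′ + P)) P+m≡d
                 (two-loops-period p₀ X c P m accepted bound same-T same₁ repeat-e)

  SmallPeriodTail : Word k → Word k → Set
  SmallPeriodTail t X = ∃ λ Q → 1 ≤ Q × Q ≤ B × Periodic X Q B (suc (length t))

  tail-period : (p₀ t u₁ v₁ : Word k) {a b : Fin k} → B ≤ length t → a ≢ b → accepts (p₀ ++ t ++ a ∷ u₁) ≡ true →
                occ (p₀ ++ t ++ a ∷ u₁) (t ++ b ∷ []) ≡ occ (p₀ ++ t ++ b ∷ v₁) (t ++ b ∷ []) →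
                SmallPeriodTail t (t ++ a ∷ u₁)
  tail-period p₀ t u₁ v₁ B≤t a≢b accepted same
    with shifted-occurrence p₀ t u₁ v₁ a≢b same
  ... | D , r , 1≤D , shift with shift-period p₀ (t ++ _ ∷ u₁) t D _ _ refl shift 1≤D B≤t accepted
  ...   | Q , 1≤Q , Q≤B , per = Q , 1≤Q , Q≤B , periodic-mono (t ++ _ ∷ u₁) ≤-refl (+-monoˡ-≤ (length t) 1≤D) per

  tails-agree : (t u₁ v₁ : Word k) {a b : Fin k} → length t ≡ K →
                SmallPeriodTail t (t ++ a ∷ u₁) → SmallPeriodTail t (t ++ b ∷ v₁) → a ≡ b
  tails-agree t u₁ v₁ {a} {b} |t|≡K (Q , 1≤Q , Q≤B , per) (Q′ , 1≤Q′ , Q′≤B , per′) = just-injective (begin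
    just a                       ≡⟨ sym (at-length t u₁ a) ⟩
    at (t ++ a ∷ u₁) (length t)  ≡⟨ periodic-agree (t ++ a ∷ u₁) (t ++ b ∷ v₁) (λ i → at-common-prefix t (a ∷ u₁) (b ∷ v₁))
                                      1≤Q 1≤Q′ bound per per′ ⟩
    at (t ++ b ∷ v₁) (length t)  ≡⟨ at-length t v₁ b ⟩
    just b                       ∎)
    where
    open ≡-Reasoning
    bound : B + Q * Q′ ≤ length t
    bound = subst (B + Q * Q′ ≤_) (sym |t|≡K) (+-monoʳ-≤ B (*-mono-≤ Q≤B Q′≤B))

  long-difference : (p₀ t u₁ v₁ : Word k) {a b : Fin k} → length t ≡ K → a ≢ b →
                    accepts (p₀ ++ t ++ a ∷ u₁) ≡ true → accepts (p₀ ++ t ++ b ∷ v₁) ≡ true →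
                    ((c : Fin k) → occ (p₀ ++ t ++ a ∷ u₁) (t ++ c ∷ []) ≡ occ (p₀ ++ t ++ b ∷ v₁) (t ++ c ∷ [])) → ⊥
  long-difference p₀ t u₁ v₁ {a} {b} |t|≡K a≢b accepted-u accepted-v same =
    a≢b (tails-agree t u₁ v₁ |t|≡K (tail-period p₀ t u₁ v₁ B≤t a≢b accepted-u (same b))
                                   (tail-period p₀ t v₁ u₁ B≤t (λ b≡a → a≢b (sym b≡a)) accepted-v (sym (same a))))
    where
    B≤t : B ≤ length t
    B≤t = subst (B ≤_) (sym |t|≡K) (m≤m+n B (B * B))

  -- A short first difference: the factor p a is a prefix of u = p a u₁ but not of
  -- v = p b v₁, so the counts of p a and its one-letter left extensions cannot all agree.
  short-difference : (p u₁ v₁ : Word k) {a b : Fin k} → a ≢ b →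
                     ((f : Word k) → length f ≤ suc (suc (length p)) → occ (p ++ a ∷ u₁) f ≡ occ (p ++ b ∷ v₁) f) → ⊥
  short-difference p u₁ v₁ {a} {b} a≢b same = true≢false (begin
    true                        ≡⟨ sym pa-prefix-of-u ⟩
    isPrefix pa (p ++ a ∷ u₁)   ≡⟨ prefix-from-counts _ _ pa (same pa (≤-trans (≤-reflexive |pa|) (n≤1+n _)))
                                                             (λ c → same (c ∷ pa) (s≤s (≤-reflexive |pa|))) ⟩
    isPrefix pa (p ++ b ∷ v₁)   ≡⟨ isPrefix-mismatch p [] v₁ a≢b ⟩
    false                       ∎)
    where
    open ≡-Reasoning
    pa = p ++ a ∷ []
    |pa| : length pa ≡ suc (length p)
    |pa| = trans (length-++ p) (+-comm (length p) 1)
    pa-prefix-of-u : isPrefix pa (p ++ a ∷ u₁) ≡ true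
    pa-prefix-of-u = subst (λ w → isPrefix pa w ≡ true) (++-assoc p (a ∷ []) u₁) (isPrefix-refl pa u₁)
    true≢false : true ≢ false
    true≢false ()

  -- Equal counts of
  -- ε give equal lengths; at the first difference p a / p b, a short p is handled by
  -- short-difference, a long p = p₀ t (|t| = K) by long-difference.
  N : ℕ
  N = suc K

  short-factors-separate : (u v : Word k) → accepts u ≡ true → accepts v ≡ true → u ≢ v →
                           ((f : Word k) → length f ≤ N → occ u f ≡ occ v f) → ⊥
  short-factors-separate u v accepted-u accepted-v u≢v same
    with first-difference _≟ᶠ_ u v u≢v (suc-injective (trans (sym (occ-ε u)) (trans (same [] z≤n) (occ-ε v))))
  ... | p , a , b , u₁ , v₁ , a≢b , refl , refl with length p <? K
  ...   | yes short = short-difference p u₁ v₁ a≢b (λ f le → same f (≤-trans le (s≤s short)))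
  ...   | no long   = long-difference p₀ t u₁ v₁ |t|≡K a≢b
                        (subst (λ w → accepts w ≡ true) (regroup a u₁) accepted-u)
                        (subst (λ w → accepts w ≡ true) (regroup b v₁) accepted-v)
                        (λ c → subst₂ (λ w w′ → occ w (t ++ c ∷ []) ≡ occ w′ (t ++ c ∷ [])) (regroup a u₁) (regroup b v₁)
                                 (same (t ++ c ∷ []) (≤-reflexive (|tc| c))))
    where
    j  = length p ∸ K
    p₀ = take j p
    t  = drop j p
    |t|≡K : length t ≡ K
    |t|≡K = trans (length-drop j p) (m∸[m∸n]≡n (≮⇒≥ long))
    |tc| : (c : Fin k) → length (t ++ c ∷ []) ≡ N
    |tc| c = trans (length-++ t) (trans (+-comm (length t) 1) (cong suc |t|≡K))
    regroup : (c : Fin k) (r : Word k) → p ++ c ∷ r ≡ p₀ ++ t ++ c ∷ r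
    regroup c r = trans (cong (_++ c ∷ r) (sym (take++drop≡id j p))) (++-assoc p₀ t (c ∷ r))

noPattern⇒finiteSSF : {k : ℕ} (L : Language k) → IsRegular L → ¬ HasPattern L → HasFiniteSSF L
noPattern⇒finiteSSF {k} L (A , L⇔A) no-pattern = wordsUpTo N , separates
  where
  commutes : (T x Y Z : Word k) → ((i j : ℕ) → DFA.accepts A (x ++ (T ^ʷ i) ++ Y ++ (T ^ʷ j) ++ Z) ≡ true) →
             T ++ Y ≡ Y ++ T
  commutes T x Y Z pumped with ≡-dec _≟ᶠ_ (T ++ Y) (Y ++ T)
  ... | yes comm = comm
  ... | no ¬comm = ⊥-elim (no-pattern (T , x , Y , Z , ¬comm , λ i j → Equivalence.from (L⇔A _) (pumped i j)))
  open NoPattern A commutes using (N; short-factors-separate)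
  separates : IsSSF (wordsUpTo N) L
  separates u v u∈L v∈L u≢v with any? (λ f → ¬? (occ u f ≟ occ v f)) (wordsUpTo N)
  ... | yes differs = find differs
  ... | no ¬differs = ⊥-elim (short-factors-separate u v (Equivalence.to (L⇔A u) u∈L) (Equivalence.to (L⇔A v) v∈L) u≢v same)
    where
    same : (f : Word k) → length f ≤ N → occ u f ≡ occ v f
    same f le = decidable-stable (occ u f ≟ occ v f) (λ u≢v → ¬differs (lose (wordsUpTo-complete N f le) u≢v))

theorem3 : (k : ℕ) (L : Language k) → IsRegular L →
    HasFiniteSSF L ⇔
    (¬ (Σ (Word k) λ w → Σ (Word k) λ x → Σ (Word k) λ y → Σ (Word k) λ z →
          (w ++ y ≢ y ++ w) ×
          ((i j : ℕ) → L (x ++ (w ^ʷ i) ++ y ++ (w ^ʷ j) ++ z))))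
theorem3 k L regular = mk⇔ (finiteSSF⇒noPattern L) (noPattern⇒finiteSSF L regular)
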